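{- For every $n\ge 1$, $$n!\sum_{T\in PT(n)}\prod_{h\in\mathcal{H}(T)}\Big(1-\frac{1}{h}\Big)^{h-1}=(n-1)^{n-1}.$$
   Context: A plane tree is a rooted unlabeled tree in which the (nonempty) subtrees of each vertex are arranged in linear order; $PT(n)$ is the set of plane trees with $n$ vertices. For a vertex $u$ of a tree $T$, the hook length $h_u$ is the number of descendants of $u$ (counting $u$ itself), and $\mathcal{H}(T)$ is the multiset of hook lengths of the vertices; the product is over all vertices. The convention $0^0=1$ is used. -}

module Defs where

open import Data.Nat using (ℕ; zero; suc; _+_)
open import Data.Integer using (+_)
open import Data.List using (List; []; _∷_; _++_; foldr; map)
open import Data.Rational using (ℚ; _/_; 1ℚ; 0ℚ) renaming (_*_ to _*ℚ_; _+_ to _+ℚ_; _-_ to _-ℚ_)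

data PTree : Set where
  node : List PTree → PTree

mutual
  size : PTree → ℕ
  size (node ts) = suc (sizes ts)

  sizes : List PTree → ℕ
  sizes []       = 0
  sizes (t ∷ ts) = size t + sizes ts

mutual
  -- multiset H(T) of hook lengths (one entry per vertex);
  -- the hook length of a vertex is the size of the subtree rooted there
  hooks : PTree → List ℕ
  hooks (node ts) = size (node ts) ∷ hooksF ts

  hooksF : List PTree → List ℕ
  hooksF []       = []
  hooksF (t ∷ ts) = hooks t ++ hooksF ts

-- rational power with natural exponent (so 0^0 = 1)
_^ℚ_ : ℚ → ℕ → ℚ
q ^ℚ zero  = 1ℚ
q ^ℚ suc k = q *ℚ (q ^ℚ k)

sumℚ : List ℚ → ℚ
sumℚ = foldr _+ℚ_ 0ℚ

productℚ : List ℚ → ℚ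
productℚ = foldr _*ℚ_ 1ℚ

-- the weight (1 - 1/h)^(h-1); hook lengths are always ≥ 1, value at 0 is irrelevant
weight : ℕ → ℚ
weight zero    = 1ℚ
weight (suc k) = (1ℚ -ℚ (+ 1 / suc k)) ^ℚ k

hookWeight : PTree → ℚ
hookWeight T = productℚ (map weight (hooks T))

ℕtoℚ : ℕ → ℚ
ℕtoℚ n = + n / 1

-- A plane tree with n vertices is a root above a forest with n - 1 vertices, and the hook
-- weight of the root is weight n.  Writing G m for the total hook weight of the forests with m
-- vertices, cutting off the first tree gives  G (m + 1) = ∑ₖ weight (k + 1) G k G (m - k).
-- With the Abel polynomials  aₖ(x) = x (x + k)^(k-1) / k!,  one has
-- weight (k + 1) aₖ(1) = k^k / (k + 1)! = - aₖ₊₁(-1),  so the recursion for G is the Abel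
-- convolution  ∑ₖ aₖ(-1) aₘ₊₁₋ₖ(1) = aₘ₊₁(0) = 0  and G m = aₘ(1) = (m + 1)^(m-1) / m!.
-- The tree sum is then weight n · G (n - 1) = (n - 1)^(n-1) / n!.
-- The convolution identity is Abel's identity, proved by expanding it in y around
-- y = -(x + n), where it becomes an n-th finite difference of a polynomial of degree n - 1.

module Submission where

open import Defs
open import Data.Nat as ℕ using (ℕ; zero; suc; _≤_; _<_; _≥_; s≤s; _∸_; _!; NonZero)
import Data.Nat.Properties as ℕ
open import Data.Nat.Induction using (<-rec)
import Data.Integer as ℤ
import Data.Integer.Properties as ℤ
open import Data.Rational using (ℚ; 0ℚ; 1ℚ; _+_; _*_; -_; _-_; _/_; toℚᵘ)
import Data.Rational.Properties as ℚ
import Data.Rational.Unnormalised as ℚᵘ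
import Data.Rational.Unnormalised.Properties as ℚᵘ
open import Data.Rational.Solver using (module +-*-Solver)
open +-*-Solver
open import Data.List using (List; []; _∷_; _++_; map; cartesianProductWith)
open import Data.List.Properties using (map-++; map-∘)
open import Data.List.Relation.Unary.Any using (here; there)
open import Data.List.Membership.Propositional using (_∈_)
open import Data.List.Membership.Propositional.Properties
  using (∈-++⁻; ∈-++⁺ˡ; ∈-++⁺ʳ; ∈-map⁺; ∈-map⁻; ∈-cartesianProductWith⁺; ∈-cartesianProductWith⁻)
open import Data.List.Membership.Propositional.Properties.WithK using (unique∧set⇒bag)
open import Data.List.Relation.Binary.BagAndSetEquality using (∼bag⇒↭)
open import Data.List.Relation.Binary.Permutation.Propositional using (↭⇒↭ₛ)
import Data.List.Relation.Binary.Permutation.Propositional.Properties as ↭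
open import Data.List.Relation.Binary.Permutation.Setoid.Properties using (foldr-commMonoid)
open import Function.Bundles using (_⇔_; mk⇔; Equivalence)
import Data.List.Relation.Unary.All as All
open import Data.List.Relation.Unary.AllPairs using ([]; _∷_)
open import Data.List.Relation.Unary.Unique.Propositional using (Unique)
import Data.List.Relation.Unary.Unique.Propositional.Properties as Unique
open import Data.List.Relation.Binary.Disjoint.Propositional using (Disjoint)
open import Data.Product using (_×_; _,_; proj₁; proj₂; ∃-syntax)
open import Data.Sum using (inj₁; inj₂)
open import Function using (_∘_)
open import Relation.Binary.PropositionalEquality

-- Natural numbers and factorials in ℚ

-- Unlike ℕtoℚ, this embedding unfolds definitionally at suc, which the ring solver can see.
fromℕ : ℕ → ℚ
fromℕ zero    = 0ℚ
fromℕ (suc n) = 1ℚ + fromℕ n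

ℕtoℚ-suc : ∀ n → ℕtoℚ (suc n) ≡ 1ℚ + ℕtoℚ n
ℕtoℚ-suc n = ℚ.toℚᵘ-injective (begin
    toℚᵘ (ℕtoℚ (suc n))
      ≈⟨ ℚ.toℚᵘ-fromℚᵘ (ℚᵘ.mkℚᵘ (ℤ.+ suc n) 0) ⟩
    ℚᵘ.mkℚᵘ (ℤ.+ suc n) 0
      ≈⟨ ℚᵘ.*≡* (cong (ℤ._* ℤ.+ 1) (cong (λ z → ℤ.+ 1 ℤ.+ z) (sym (ℤ.*-identityʳ (ℤ.+ n))))) ⟩
    ℚᵘ.1ℚᵘ ℚᵘ.+ ℚᵘ.mkℚᵘ (ℤ.+ n) 0
      ≈⟨ ℚᵘ.+-congʳ ℚᵘ.1ℚᵘ (ℚ.toℚᵘ-fromℚᵘ (ℚᵘ.mkℚᵘ (ℤ.+ n) 0)) ⟨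
    toℚᵘ 1ℚ ℚᵘ.+ toℚᵘ (ℕtoℚ n)
      ≈⟨ ℚ.toℚᵘ-homo-+ 1ℚ (ℕtoℚ n) ⟨
    toℚᵘ (1ℚ + ℕtoℚ n) ∎)
  where open ℚᵘ.≃-Reasoning

ℕtoℚ≡fromℕ : ∀ n → ℕtoℚ n ≡ fromℕ n
ℕtoℚ≡fromℕ zero    = refl
ℕtoℚ≡fromℕ (suc n) = trans (ℕtoℚ-suc n) (cong (1ℚ +_) (ℕtoℚ≡fromℕ n))

fromℕ-+ : ∀ m n → fromℕ (m ℕ.+ n) ≡ fromℕ m + fromℕ n
fromℕ-+ zero    n = sym (ℚ.+-identityˡ (fromℕ n))
fromℕ-+ (suc m) n = trans (cong (1ℚ +_) (fromℕ-+ m n)) (sym (ℚ.+-assoc 1ℚ (fromℕ m) (fromℕ n)))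

fromℕ-* : ∀ m n → fromℕ (m ℕ.* n) ≡ fromℕ m * fromℕ n
fromℕ-* zero    n = sym (ℚ.*-zeroˡ (fromℕ n))
fromℕ-* (suc m) n = begin
  fromℕ (n ℕ.+ m ℕ.* n)          ≡⟨ fromℕ-+ n (m ℕ.* n) ⟩
  fromℕ n + fromℕ (m ℕ.* n)      ≡⟨ cong (fromℕ n +_) (fromℕ-* m n) ⟩
  fromℕ n + fromℕ m * fromℕ n    ≡⟨ solve 2 (λ a b → b :+ a :* b := (con 1ℚ :+ a) :* b) refl (fromℕ m) (fromℕ n) ⟩
  fromℕ (suc m) * fromℕ n        ∎
  where open ≡-Reasoning

fromℕ-∸ : ∀ {m n} → n ≤ m → fromℕ (m ∸ n) ≡ fromℕ m - fromℕ n
fromℕ-∸ {m} {n} n≤m = begin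
  fromℕ (m ∸ n)                              ≡⟨ solve 2 (λ a b → a := (a :+ b) :- b) refl (fromℕ (m ∸ n)) (fromℕ n) ⟩
  (fromℕ (m ∸ n) + fromℕ n) - fromℕ n        ≡⟨ cong (_- fromℕ n) (fromℕ-+ (m ∸ n) n) ⟨
  fromℕ (m ∸ n ℕ.+ n) - fromℕ n              ≡⟨ cong (λ k → fromℕ k - fromℕ n) (ℕ.m∸n+n≡m n≤m) ⟩
  fromℕ m - fromℕ n                          ∎
  where open ≡-Reasoning

fromℕ-^ : ∀ m n → fromℕ (m ℕ.^ n) ≡ fromℕ m ^ℚ n
fromℕ-^ m zero    = refl
fromℕ-^ m (suc n) = trans (fromℕ-* m (m ℕ.^ n)) (cong (fromℕ m *_) (fromℕ-^ m n))

-- The same term as the 1/h in weight.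
inv : (d : ℕ) .{{_ : NonZero d}} → ℚ
inv d = ℤ.+ 1 / d

ℕtoℚ-*-inv : ∀ d .{{_ : NonZero d}} → ℕtoℚ d * inv d ≡ 1ℚ
ℕtoℚ-*-inv (suc d) = ℚ.toℚᵘ-injective (begin
    toℚᵘ (ℕtoℚ (suc d) * inv (suc d))
      ≈⟨ ℚ.toℚᵘ-homo-* (ℕtoℚ (suc d)) (inv (suc d)) ⟩
    toℚᵘ (ℕtoℚ (suc d)) ℚᵘ.* toℚᵘ (inv (suc d))
      ≈⟨ ℚᵘ.*-cong (ℚ.toℚᵘ-fromℚᵘ (ℚᵘ.mkℚᵘ (ℤ.+ suc d) 0)) (ℚ.toℚᵘ-fromℚᵘ (ℚᵘ.mkℚᵘ (ℤ.+ 1) d)) ⟩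
    ℚᵘ.mkℚᵘ (ℤ.+ suc d) 0 ℚᵘ.* ℚᵘ.mkℚᵘ (ℤ.+ 1) d
      ≈⟨ ℚᵘ.*≡* cross ⟩
    ℚᵘ.1ℚᵘ ∎)
  where
  open ℚᵘ.≃-Reasoning
  cross : (ℤ.+ suc d ℤ.* ℤ.+ 1) ℤ.* ℤ.+ 1 ≡ ℤ.+ 1 ℤ.* ℤ.+ (1 ℕ.* suc d)
  cross = trans (ℤ.*-identityʳ _) (trans (ℤ.*-identityʳ _)
            (sym (trans (ℤ.*-identityˡ _) (cong ℤ.+_ (ℕ.*-identityˡ (suc d))))))

fromℕ-*-inv : ∀ d .{{_ : NonZero d}} → fromℕ d * inv d ≡ 1ℚ
fromℕ-*-inv d = trans (cong (_* inv d) (sym (ℕtoℚ≡fromℕ d))) (ℕtoℚ-*-inv d)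

inv-*-fromℕ-* : ∀ d .{{_ : NonZero d}} p → inv d * (fromℕ d * p) ≡ p
inv-*-fromℕ-* d p = begin
  inv d * (fromℕ d * p)   ≡⟨ solve 3 (λ i q a → i :* (q :* a) := (q :* i) :* a) refl (inv d) (fromℕ d) p ⟩
  (fromℕ d * inv d) * p   ≡⟨ cong (_* p) (fromℕ-*-inv d) ⟩
  1ℚ * p                  ≡⟨ ℚ.*-identityˡ p ⟩
  p                       ∎
  where open ≡-Reasoning

fromℕ-suc-*-cancelˡ : ∀ m {p q} → fromℕ (suc m) * p ≡ fromℕ (suc m) * q → p ≡ q
fromℕ-suc-*-cancelˡ m {p} {q} eq = begin
  p                                  ≡⟨ inv-*-fromℕ-* (suc m) p ⟨
  inv (suc m) * (fromℕ (suc m) * p)  ≡⟨ cong (inv (suc m) *_) eq ⟩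
  inv (suc m) * (fromℕ (suc m) * q)  ≡⟨ inv-*-fromℕ-* (suc m) q ⟩
  q                                  ∎
  where open ≡-Reasoning

invFact : ℕ → ℚ
invFact n = inv (n !) {{n ℕ.!≢0}}

fromℕ!-*-invFact : ∀ n → fromℕ (n !) * invFact n ≡ 1ℚ
fromℕ!-*-invFact n = fromℕ-*-inv (n !) {{n ℕ.!≢0}}

invFact-suc : ∀ n → invFact n ≡ fromℕ (suc n) * invFact (suc n)
invFact-suc n = begin
  invFact n                                                 ≡⟨ ℚ.*-identityʳ (invFact n) ⟨
  invFact n * 1ℚ                                            ≡⟨ cong (invFact n *_) (fromℕ!-*-invFact (suc n)) ⟨
  invFact n * (fromℕ (suc n ℕ.* n !) * invFact (suc n))     ≡⟨ cong (λ z → invFact n * (z * invFact (suc n))) (fromℕ-* (suc n) (n !)) ⟩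
  invFact n * (fromℕ (suc n) * fromℕ (n !) * invFact (suc n))
    ≡⟨ solve 4 (λ i s f j → i :* (s :* f :* j) := (f :* i) :* (s :* j)) refl (invFact n) (fromℕ (suc n)) (fromℕ (n !)) (invFact (suc n)) ⟩
  (fromℕ (n !) * invFact n) * (fromℕ (suc n) * invFact (suc n))
    ≡⟨ cong (_* (fromℕ (suc n) * invFact (suc n))) (fromℕ!-*-invFact n) ⟩
  1ℚ * (fromℕ (suc n) * invFact (suc n))                    ≡⟨ ℚ.*-identityˡ _ ⟩
  fromℕ (suc n) * invFact (suc n)                           ∎
  where open ≡-Reasoning

^ℚ-+ : ∀ u a b → u ^ℚ (a ℕ.+ b) ≡ u ^ℚ a * u ^ℚ b
^ℚ-+ u zero    b = sym (ℚ.*-identityˡ _)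
^ℚ-+ u (suc a) b = trans (cong (u *_) (^ℚ-+ u a b)) (sym (ℚ.*-assoc u (u ^ℚ a) (u ^ℚ b)))

^ℚ-distrib-* : ∀ u v a → (u * v) ^ℚ a ≡ u ^ℚ a * v ^ℚ a
^ℚ-distrib-* u v zero    = refl
^ℚ-distrib-* u v (suc a) = trans (cong ((u * v) *_) (^ℚ-distrib-* u v a))
  (solve 4 (λ x y z w → (x :* y) :* (z :* w) := (x :* z) :* (y :* w)) refl u v (u ^ℚ a) (v ^ℚ a))

1^ℚ : ∀ a → 1ℚ ^ℚ a ≡ 1ℚ
1^ℚ zero    = refl
1^ℚ (suc a) = trans (ℚ.*-identityˡ _) (1^ℚ a)

∸-swap : ∀ n k j → (n ∸ k) ∸ j ≡ (n ∸ j) ∸ k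
∸-swap n k j = trans (ℕ.∸-+-assoc n k j) (trans (cong (n ∸_) (ℕ.+-comm k j)) (sym (ℕ.∸-+-assoc n j k)))

-- Finite sums

∑< : ℕ → (ℕ → ℚ) → ℚ
∑< zero    f = 0ℚ
∑< (suc n) f = ∑< n f + f n

-- The body of ∑[ i < n ] extends over products but not over sums.
infix 6.5 ∑<
syntax ∑< n (λ i → e) = ∑[ i < n ] e

∑-cong : ∀ n {f g : ℕ → ℚ} → (∀ i → i < n → f i ≡ g i) → ∑< n f ≡ ∑< n g
∑-cong zero    eq = refl
∑-cong (suc n) eq = cong₂ _+_ (∑-cong n (λ i i<n → eq i (ℕ.m<n⇒m<1+n i<n))) (eq n ℕ.≤-refl)

∑-zero : ∀ n {f : ℕ → ℚ} → (∀ i → i < n → f i ≡ 0ℚ) → ∑< n f ≡ 0ℚ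
∑-zero zero    eq = refl
∑-zero (suc n) eq = cong₂ _+_ (∑-zero n (λ i i<n → eq i (ℕ.m<n⇒m<1+n i<n))) (eq n ℕ.≤-refl)

∑-distrib-+ : ∀ n (f g : ℕ → ℚ) → ∑[ i < n ] (f i + g i) ≡ ∑< n f + ∑< n g
∑-distrib-+ zero    f g = refl
∑-distrib-+ (suc n) f g = trans (cong (_+ (f n + g n)) (∑-distrib-+ n f g))
  (solve 4 (λ a b c d → (a :+ b) :+ (c :+ d) := (a :+ c) :+ (b :+ d)) refl (∑< n f) (∑< n g) (f n) (g n))

∑-distribˡ : ∀ n c (f : ℕ → ℚ) → ∑[ i < n ] (c * f i) ≡ c * ∑< n f
∑-distribˡ zero    c f = sym (ℚ.*-zeroʳ c)
∑-distribˡ (suc n) c f = trans (cong (_+ c * f n) (∑-distribˡ n c f)) (sym (ℚ.*-distribˡ-+ c (∑< n f) (f n)))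

∑-neg : ∀ n (f : ℕ → ℚ) → ∑[ i < n ] (- f i) ≡ - ∑< n f
∑-neg zero    f = refl
∑-neg (suc n) f = trans (cong (_+ - f n) (∑-neg n f)) (solve 2 (λ a b → (:- a) :+ (:- b) := :- (a :+ b)) refl (∑< n f) (f n))

∑-suc : ∀ n (f : ℕ → ℚ) → ∑< (suc n) f ≡ f 0 + ∑[ i < n ] f (suc i)
∑-suc zero    f = ℚ.+-comm 0ℚ (f 0)
∑-suc (suc n) f = trans (cong (_+ f (suc n)) (∑-suc n f)) (ℚ.+-assoc (f 0) (∑[ i < n ] f (suc i)) (f (suc n)))

∑-comm : ∀ n m (h : ℕ → ℕ → ℚ) → ∑[ k < n ] ∑< m (h k) ≡ ∑[ i < m ] ∑[ k < n ] h k i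
∑-comm zero    m h = sym (∑-zero m (λ _ _ → refl))
∑-comm (suc n) m h = trans (cong (_+ ∑< m (h n)) (∑-comm n m h)) (sym (∑-distrib-+ m (λ i → ∑[ k < n ] h k i) (h n)))

∑-reverse : ∀ n (f : ℕ → ℚ) → ∑< n f ≡ ∑[ i < n ] f (n ∸ suc i)
∑-reverse zero    f = refl
∑-reverse (suc n) f = begin
  ∑< n f + f n                          ≡⟨ cong (_+ f n) (∑-reverse n f) ⟩
  ∑[ i < n ] f (n ∸ suc i) + f n        ≡⟨ ℚ.+-comm _ (f n) ⟩
  f n + ∑[ i < n ] f (n ∸ suc i)        ≡⟨ ∑-suc n (λ i → f (n ∸ i)) ⟨
  ∑[ i < suc n ] f (n ∸ i)              ∎
  where open ≡-Reasoning

∑-distrib-- : ∀ n (f g : ℕ → ℚ) → ∑[ i < n ] (f i - g i) ≡ ∑< n f - ∑< n g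
∑-distrib-- zero    f g = refl
∑-distrib-- (suc n) f g = trans (cong (_+ (f n - g n)) (∑-distrib-- n f g))
  (solve 4 (λ a b c d → (a :- b) :+ (c :- d) := (a :+ c) :- (b :+ d)) refl (∑< n f) (∑< n g) (f n) (g n))

triangle : (ℕ → ℕ → ℚ) → ℕ → ℚ
triangle h N = ∑[ k < suc N ] ∑< (suc (N ∸ k)) (h k)

antidiagonal : (ℕ → ℕ → ℚ) → ℕ → ℚ
antidiagonal h M = ∑[ k < suc M ] h k (M ∸ k)

triangle-suc : ∀ h N → triangle h (suc N) ≡ triangle h N + antidiagonal h (suc N)
triangle-suc h N = begin
  ∑[ k < suc N ] ∑< (suc (suc N ∸ k)) (h k) + ∑< (suc (N ∸ N)) (h (suc N))
    ≡⟨ cong₂ _+_ (∑-cong (suc N) split) lastRow ⟩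
  ∑[ k < suc N ] (∑< (suc (N ∸ k)) (h k) + h k (suc N ∸ k)) + (0ℚ + h (suc N) 0)
    ≡⟨ cong (_+ (0ℚ + h (suc N) 0)) (∑-distrib-+ (suc N) _ _) ⟩
  (triangle h N + ∑[ k < suc N ] h k (suc N ∸ k)) + (0ℚ + h (suc N) 0)
    ≡⟨ solve 3 (λ a b c → (a :+ b) :+ (con 0ℚ :+ c) := a :+ (b :+ c)) refl (triangle h N) (∑[ k < suc N ] h k (suc N ∸ k)) (h (suc N) 0) ⟩
  triangle h N + (∑[ k < suc N ] h k (suc N ∸ k) + h (suc N) 0)
    ≡⟨ cong (λ z → triangle h N + (∑[ k < suc N ] h k (suc N ∸ k) + h (suc N) z)) (ℕ.n∸n≡0 N) ⟨
  triangle h N + antidiagonal h (suc N) ∎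
  where
  open ≡-Reasoning
  split : ∀ k → k < suc N → ∑< (suc (suc N ∸ k)) (h k) ≡ ∑< (suc (N ∸ k)) (h k) + h k (suc N ∸ k)
  split k (s≤s k≤N) rewrite ℕ.+-∸-assoc 1 k≤N = refl
  lastRow : ∑< (suc (N ∸ N)) (h (suc N)) ≡ 0ℚ + h (suc N) 0
  lastRow rewrite ℕ.n∸n≡0 N = refl

antidiagonal-flip : ∀ h M → antidiagonal h M ≡ antidiagonal (λ a b → h b a) M
antidiagonal-flip h M = trans (∑-reverse (suc M) _) (∑-cong (suc M) flip-index)
  where
  flip-index : ∀ i → i < suc M → h (M ∸ i) (M ∸ (M ∸ i)) ≡ h (M ∸ i) i
  flip-index i (s≤s i≤M) rewrite ℕ.m∸[m∸n]≡n i≤M = refl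

∑-triangle-swap : ∀ N (h : ℕ → ℕ → ℚ) →
  ∑[ k < suc N ] ∑< (suc (N ∸ k)) (h k) ≡ ∑[ j < suc N ] ∑[ k < suc (N ∸ j) ] h k j
∑-triangle-swap zero    h = refl
∑-triangle-swap (suc N) h = begin
  triangle h (suc N)                                  ≡⟨ triangle-suc h N ⟩
  triangle h N + antidiagonal h (suc N)               ≡⟨ cong₂ _+_ (∑-triangle-swap N h) (antidiagonal-flip h (suc N)) ⟩
  triangle h′ N + antidiagonal h′ (suc N)             ≡⟨ triangle-suc h′ N ⟨
  triangle h′ (suc N)                                 ∎
  where
  open ≡-Reasoning
  h′ : ℕ → ℕ → ℚ
  h′ a b = h b a

-- Divided powers and the binomial theorem

divPow : ℚ → ℕ → ℚ
divPow u m = u ^ℚ m * invFact m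

divPow-0 : ∀ m → divPow 0ℚ (suc m) ≡ 0ℚ
divPow-0 m = trans (cong (_* invFact (suc m)) (ℚ.*-zeroˡ (0ℚ ^ℚ m))) (ℚ.*-zeroˡ (invFact (suc m)))

divPow-suc : ∀ u m → fromℕ (suc m) * divPow u (suc m) ≡ u * divPow u m
divPow-suc u m = begin
  fromℕ (suc m) * (u * u ^ℚ m * invFact (suc m))
    ≡⟨ solve 4 (λ q x p i → q :* (x :* p :* i) := x :* p :* (q :* i)) refl (fromℕ (suc m)) u (u ^ℚ m) (invFact (suc m)) ⟩
  u * u ^ℚ m * (fromℕ (suc m) * invFact (suc m))  ≡⟨ cong (u * u ^ℚ m *_) (invFact-suc m) ⟨
  u * u ^ℚ m * invFact m                          ≡⟨ ℚ.*-assoc u _ _ ⟩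
  u * divPow u m                                  ∎
  where open ≡-Reasoning

binomialTerm : ℚ → ℚ → ℕ → ℕ → ℚ
binomialTerm u v m j = divPow u j * divPow v (m ∸ j)

binomialSum : ℚ → ℚ → ℕ → ℚ
binomialSum u v m = ∑[ j < suc m ] binomialTerm u v m j

*-binomialSumˡ : ∀ u v m → u * binomialSum u v m ≡ ∑[ j < suc (suc m) ] fromℕ j * binomialTerm u v (suc m) j
*-binomialSumˡ u v m = begin
  u * binomialSum u v m                                        ≡⟨ ∑-distribˡ (suc m) u _ ⟨
  ∑[ j < suc m ] u * binomialTerm u v m j                      ≡⟨ ∑-cong (suc m) (λ j _ → raise j) ⟩
  ∑[ j < suc m ] fromℕ (suc j) * binomialTerm u v (suc m) (suc j)
    ≡⟨ ℚ.+-identityˡ _ ⟨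
  0ℚ + ∑[ j < suc m ] fromℕ (suc j) * binomialTerm u v (suc m) (suc j)
    ≡⟨ cong (_+ ∑[ j < suc m ] fromℕ (suc j) * binomialTerm u v (suc m) (suc j)) (ℚ.*-zeroˡ (binomialTerm u v (suc m) 0)) ⟨
  fromℕ 0 * binomialTerm u v (suc m) 0 + ∑[ j < suc m ] fromℕ (suc j) * binomialTerm u v (suc m) (suc j)
    ≡⟨ ∑-suc (suc m) _ ⟨
  ∑[ j < suc (suc m) ] fromℕ j * binomialTerm u v (suc m) j    ∎
  where
  open ≡-Reasoning
  raise : ∀ j → u * binomialTerm u v m j ≡ fromℕ (suc j) * binomialTerm u v (suc m) (suc j)
  raise j = begin
    u * (divPow u j * divPow v (m ∸ j))                     ≡⟨ ℚ.*-assoc u _ _ ⟨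
    (u * divPow u j) * divPow v (m ∸ j)                     ≡⟨ cong (_* divPow v (m ∸ j)) (divPow-suc u j) ⟨
    (fromℕ (suc j) * divPow u (suc j)) * divPow v (m ∸ j)   ≡⟨ ℚ.*-assoc (fromℕ (suc j)) _ _ ⟩
    fromℕ (suc j) * binomialTerm u v (suc m) (suc j)        ∎

*-binomialSumʳ : ∀ u v m → v * binomialSum u v m ≡ ∑[ j < suc (suc m) ] fromℕ (suc m ∸ j) * binomialTerm u v (suc m) j
*-binomialSumʳ u v m = begin
  v * binomialSum u v m                                          ≡⟨ ∑-distribˡ (suc m) v _ ⟨
  ∑[ j < suc m ] v * binomialTerm u v m j                        ≡⟨ ∑-cong (suc m) raise ⟩
  ∑[ j < suc m ] fromℕ (suc m ∸ j) * binomialTerm u v (suc m) j  ≡⟨ ℚ.+-identityʳ _ ⟨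
  ∑[ j < suc m ] fromℕ (suc m ∸ j) * binomialTerm u v (suc m) j + 0ℚ
    ≡⟨ cong (∑[ j < suc m ] fromℕ (suc m ∸ j) * binomialTerm u v (suc m) j +_) lastVanishes ⟨
  ∑[ j < suc (suc m) ] fromℕ (suc m ∸ j) * binomialTerm u v (suc m) j ∎
  where
  open ≡-Reasoning
  raise : ∀ j → j < suc m → v * binomialTerm u v m j ≡ fromℕ (suc m ∸ j) * binomialTerm u v (suc m) j
  raise j (s≤s j≤m) = begin
    v * (divPow u j * divPow v (m ∸ j))
      ≡⟨ solve 3 (λ a b c → a :* (b :* c) := b :* (a :* c)) refl v (divPow u j) (divPow v (m ∸ j)) ⟩
    divPow u j * (v * divPow v (m ∸ j))
      ≡⟨ cong (divPow u j *_) (divPow-suc v (m ∸ j)) ⟨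
    divPow u j * (fromℕ (suc (m ∸ j)) * divPow v (suc (m ∸ j)))
      ≡⟨ cong (λ k → divPow u j * (fromℕ k * divPow v k)) (ℕ.+-∸-assoc 1 j≤m) ⟨
    divPow u j * (fromℕ (suc m ∸ j) * divPow v (suc m ∸ j))
      ≡⟨ solve 3 (λ a b c → a :* (b :* c) := b :* (a :* c)) refl (divPow u j) (fromℕ (suc m ∸ j)) (divPow v (suc m ∸ j)) ⟩
    fromℕ (suc m ∸ j) * binomialTerm u v (suc m) j ∎
  lastVanishes : fromℕ (suc m ∸ suc m) * binomialTerm u v (suc m) (suc m) ≡ 0ℚ
  lastVanishes rewrite ℕ.n∸n≡0 m = ℚ.*-zeroˡ (divPow u (suc m) * divPow v 0)

-- By divPow-suc, u and v raise the index of the respective divided power; the two weights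
-- j and m + 1 - j of the resulting terms add up to m + 1.
binomialSum-suc : ∀ u v m → fromℕ (suc m) * binomialSum u v (suc m) ≡ (u + v) * binomialSum u v m
binomialSum-suc u v m = sym (begin
  (u + v) * binomialSum u v m
    ≡⟨ ℚ.*-distribʳ-+ (binomialSum u v m) u v ⟩
  u * binomialSum u v m + v * binomialSum u v m
    ≡⟨ cong₂ _+_ (*-binomialSumˡ u v m) (*-binomialSumʳ u v m) ⟩
  ∑[ j < suc (suc m) ] fromℕ j * term j + ∑[ j < suc (suc m) ] fromℕ (suc m ∸ j) * term j
    ≡⟨ ∑-distrib-+ (suc (suc m)) _ _ ⟨
  ∑[ j < suc (suc m) ] (fromℕ j * term j + fromℕ (suc m ∸ j) * term j)
    ≡⟨ ∑-cong (suc (suc m)) weightsAdd ⟩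
  ∑[ j < suc (suc m) ] fromℕ (suc m) * term j
    ≡⟨ ∑-distribˡ (suc (suc m)) (fromℕ (suc m)) term ⟩
  fromℕ (suc m) * binomialSum u v (suc m) ∎)
  where
  open ≡-Reasoning
  term : ℕ → ℚ
  term = binomialTerm u v (suc m)
  weightsAdd : ∀ j → j < suc (suc m) → fromℕ j * term j + fromℕ (suc m ∸ j) * term j ≡ fromℕ (suc m) * term j
  weightsAdd j (s≤s j≤1+m) = trans (cong (λ z → fromℕ j * term j + z * term j) (fromℕ-∸ j≤1+m))
    (solve 3 (λ a b t → a :* t :+ (b :- a) :* t := b :* t) refl (fromℕ j) (fromℕ (suc m)) (term j))

binomial : ∀ u v m → divPow (u + v) m ≡ binomialSum u v m
binomial u v zero    = refl
binomial u v (suc m) = fromℕ-suc-*-cancelˡ m (begin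
  fromℕ (suc m) * divPow (u + v) (suc m)   ≡⟨ divPow-suc (u + v) m ⟩
  (u + v) * divPow (u + v) m               ≡⟨ cong ((u + v) *_) (binomial u v m) ⟩
  (u + v) * binomialSum u v m              ≡⟨ binomialSum-suc u v m ⟨
  fromℕ (suc m) * binomialSum u v (suc m)  ∎)
  where open ≡-Reasoning

-- Finite differences

Δ : (ℕ → ℚ) → ℕ → ℚ
Δ g k = g (suc k) - g k

binomialWeight : ℕ → ℕ → ℚ
binomialWeight n k = invFact k * invFact (n ∸ k)

binomialWeight-pascal : ∀ n j → j < n →
  fromℕ (suc n) * binomialWeight (suc n) (suc j) ≡ binomialWeight n j + binomialWeight n (suc j)
binomialWeight-pascal n j j<n = begin
  fromℕ (suc n) * (invFact (suc j) * invFact (n ∸ j))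
    ≡⟨ cong₂ (λ x y → x * (invFact (suc j) * invFact y)) n+1≡ n∸j≡ ⟩
  (fromℕ (suc a) + fromℕ (suc j)) * (invFact (suc j) * invFact (suc a))
    ≡⟨ solve 4 (λ qa qj ij ia → (qa :+ qj) :* (ij :* ia) := (qj :* ij) :* ia :+ ij :* (qa :* ia)) refl
               (fromℕ (suc a)) (fromℕ (suc j)) (invFact (suc j)) (invFact (suc a)) ⟩
  (fromℕ (suc j) * invFact (suc j)) * invFact (suc a) + invFact (suc j) * (fromℕ (suc a) * invFact (suc a))
    ≡⟨ cong₂ (λ x y → x * invFact (suc a) + invFact (suc j) * y) (invFact-suc j) (invFact-suc a) ⟨
  invFact j * invFact (suc a) + invFact (suc j) * invFact a
    ≡⟨ cong (λ z → invFact j * invFact z + invFact (suc j) * invFact a) n∸j≡ ⟨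
  binomialWeight n j + binomialWeight n (suc j) ∎
  where
  open ≡-Reasoning
  a : ℕ
  a = n ∸ suc j
  n∸j≡ : n ∸ j ≡ suc a
  n∸j≡ = ℕ.+-∸-assoc 1 j<n
  n+1≡ : fromℕ (suc n) ≡ fromℕ (suc a) + fromℕ (suc j)
  n+1≡ = trans (cong (λ k → fromℕ (suc k)) (sym (ℕ.m∸n+n≡m j<n))) (fromℕ-+ (suc a) (suc j))

diffCoeff : ℕ → ℕ → ℚ
diffCoeff n k = (- 1ℚ) ^ℚ (n ∸ k) * binomialWeight n k

diffCoeff-first : ∀ n → fromℕ (suc n) * diffCoeff (suc n) 0 ≡ - diffCoeff n 0
diffCoeff-first n = begin
  fromℕ (suc n) * ((- 1ℚ) * s * (i₀ * invFact (suc n)))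
    ≡⟨ solve 4 (λ q s i₀ i → q :* ((:- con 1ℚ) :* s :* (i₀ :* i)) := :- (s :* (i₀ :* (q :* i)))) refl
               (fromℕ (suc n)) s i₀ (invFact (suc n)) ⟩
  - (s * (i₀ * (fromℕ (suc n) * invFact (suc n))))
    ≡⟨ cong (λ z → - (s * (i₀ * z))) (invFact-suc n) ⟨
  - diffCoeff n 0 ∎
  where
  open ≡-Reasoning
  s i₀ : ℚ
  s  = (- 1ℚ) ^ℚ n
  i₀ = invFact 0

diffCoeff-inner : ∀ n j → j < n → fromℕ (suc n) * diffCoeff (suc n) (suc j) ≡ diffCoeff n j - diffCoeff n (suc j)
diffCoeff-inner n j j<n = begin
  fromℕ (suc n) * (σ * binomialWeight (suc n) (suc j))
    ≡⟨ solve 3 (λ q s w → q :* (s :* w) := s :* (q :* w)) refl (fromℕ (suc n)) σ (binomialWeight (suc n) (suc j)) ⟩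
  σ * (fromℕ (suc n) * binomialWeight (suc n) (suc j))
    ≡⟨ cong (σ *_) (binomialWeight-pascal n j j<n) ⟩
  σ * (binomialWeight n j + binomialWeight n (suc j))
    ≡⟨ ℚ.*-distribˡ-+ σ _ _ ⟩
  σ * binomialWeight n j + σ * binomialWeight n (suc j)
    ≡⟨ cong (λ z → σ * binomialWeight n j + z * binomialWeight n (suc j)) (cong ((- 1ℚ) ^ℚ_) (ℕ.+-∸-assoc 1 j<n)) ⟩
  σ * binomialWeight n j + (- 1ℚ) * σ′ * binomialWeight n (suc j)
    ≡⟨ solve 3 (λ a s′ b → a :+ (:- con 1ℚ) :* s′ :* b := a :- s′ :* b) refl (σ * binomialWeight n j) σ′ (binomialWeight n (suc j)) ⟩
  diffCoeff n j - diffCoeff n (suc j) ∎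
  where
  open ≡-Reasoning
  σ σ′ : ℚ
  σ  = (- 1ℚ) ^ℚ (n ∸ j)
  σ′ = (- 1ℚ) ^ℚ (n ∸ suc j)

diffCoeff-last : ∀ n → fromℕ (suc n) * diffCoeff (suc n) (suc n) ≡ diffCoeff n n
diffCoeff-last n = begin
  fromℕ (suc n) * (s * (invFact (suc n) * i))
    ≡⟨ solve 4 (λ q s a i → q :* (s :* (a :* i)) := s :* ((q :* a) :* i)) refl (fromℕ (suc n)) s (invFact (suc n)) i ⟩
  s * ((fromℕ (suc n) * invFact (suc n)) * i)
    ≡⟨ cong (λ z → s * (z * i)) (invFact-suc n) ⟨
  diffCoeff n n ∎
  where
  open ≡-Reasoning
  s i : ℚ
  s = (- 1ℚ) ^ℚ (n ∸ n)
  i = invFact (n ∸ n)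

-- The n-th forward difference of g at 0, divided by n!.
diff : ℕ → (ℕ → ℚ) → ℚ
diff n g = ∑[ k < suc n ] diffCoeff n k * g k

diff-suc : ∀ n g → fromℕ (suc n) * diff (suc n) g ≡ diff n (Δ g)
diff-suc n g = begin
  q * diff (suc n) g
    ≡⟨ ∑-distribˡ (suc (suc n)) q _ ⟨
  ∑[ k < suc (suc n) ] q * (diffCoeff (suc n) k * g k)
    ≡⟨ ∑-suc (suc n) _ ⟩
  q * (diffCoeff (suc n) 0 * g 0) + (∑[ j < n ] q * (diffCoeff (suc n) (suc j) * g (suc j))
                                      + q * (diffCoeff (suc n) (suc n) * g (suc n)))
    ≡⟨ cong₂ (λ x y → x + (y + q * (diffCoeff (suc n) (suc n) * g (suc n)))) (rescale 0 (diffCoeff-first n)) (∑-cong n (λ j j<n → trans (rescale (suc j) (diffCoeff-inner n j j<n)) (split j))) ⟩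
  - diffCoeff n 0 * g 0 + (∑[ j < n ] (A j - B j) + q * (diffCoeff (suc n) (suc n) * g (suc n)))
    ≡⟨ cong₂ (λ x y → - diffCoeff n 0 * g 0 + (x + y)) (∑-distrib-- n A B) (rescale (suc n) (diffCoeff-last n)) ⟩
  - diffCoeff n 0 * g 0 + ((∑< n A - ∑< n B) + A n)
    ≡⟨ solve 5 (λ c x a b aₙ → (:- c) :* x :+ ((a :- b) :+ aₙ) := (a :+ aₙ) :- (c :* x :+ b)) refl
               (diffCoeff n 0) (g 0) (∑< n A) (∑< n B) (A n) ⟩
  ∑< (suc n) A - (diffCoeff n 0 * g 0 + ∑< n B)
    ≡⟨ cong (λ z → ∑< (suc n) A - z) (∑-suc n (λ k → diffCoeff n k * g k)) ⟨
  ∑< (suc n) A - ∑[ k < suc n ] diffCoeff n k * g k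
    ≡⟨ ∑-distrib-- (suc n) A _ ⟨
  ∑[ k < suc n ] (A k - diffCoeff n k * g k)
    ≡⟨ ∑-cong (suc n) (λ k _ → solve 3 (λ c x y → c :* x :- c :* y := c :* (x :- y)) refl (diffCoeff n k) (g (suc k)) (g k)) ⟩
  diff n (Δ g) ∎
  where
  open ≡-Reasoning
  q : ℚ
  q = fromℕ (suc n)
  A B : ℕ → ℚ
  A j = diffCoeff n j * g (suc j)
  B j = diffCoeff n (suc j) * g (suc j)
  rescale : ∀ k {c} → q * diffCoeff (suc n) k ≡ c → q * (diffCoeff (suc n) k * g k) ≡ c * g k
  rescale k eq = trans (sym (ℚ.*-assoc q _ (g k))) (cong (_* g k) eq)
  split : ∀ j → (diffCoeff n j - diffCoeff n (suc j)) * g (suc j) ≡ A j - B j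
  split j = solve 3 (λ a b x → (a :- b) :* x := a :* x :- b :* x) refl (diffCoeff n j) (diffCoeff n (suc j)) (g (suc j))

diff-linear : ∀ n d (w : ℕ → ℚ) (f : ℕ → ℕ → ℚ) →
  diff n (λ k → ∑[ i < d ] w i * f i k) ≡ ∑[ i < d ] w i * diff n (f i)
diff-linear n d w f = begin
  ∑[ k < suc n ] diffCoeff n k * (∑[ i < d ] w i * f i k)
    ≡⟨ ∑-cong (suc n) (λ k _ → sym (∑-distribˡ d (diffCoeff n k) _)) ⟩
  ∑[ k < suc n ] ∑[ i < d ] diffCoeff n k * (w i * f i k)
    ≡⟨ ∑-comm (suc n) d _ ⟩
  ∑[ i < d ] ∑[ k < suc n ] diffCoeff n k * (w i * f i k)
    ≡⟨ ∑-cong d (λ i _ → ∑-cong (suc n) (λ k _ → solve 3 (λ c x y → c :* (x :* y) := x :* (c :* y)) refl (diffCoeff n k) (w i) (f i k))) ⟩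
  ∑[ i < d ] ∑[ k < suc n ] w i * (diffCoeff n k * f i k)
    ≡⟨ ∑-cong d (λ i _ → ∑-distribˡ (suc n) (w i) _) ⟩
  ∑[ i < d ] w i * diff n (f i) ∎
  where open ≡-Reasoning

Δ-divPow : ∀ c d k →
  Δ (λ k → divPow (c + fromℕ k) d) k ≡ ∑[ i < d ] divPow 1ℚ (d ∸ i) * divPow (c + fromℕ k) i
Δ-divPow c d k = begin
  divPow (c + fromℕ (suc k)) d - x
    ≡⟨ cong (λ z → divPow z d - x) (solve 2 (λ c q → c :+ (con 1ℚ :+ q) := (c :+ q) :+ con 1ℚ) refl c (fromℕ k)) ⟩
  divPow (c + fromℕ k + 1ℚ) d - x
    ≡⟨ cong (_- x) (binomial (c + fromℕ k) 1ℚ d) ⟩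
  (∑[ i < d ] divPow (c + fromℕ k) i * divPow 1ℚ (d ∸ i) + x * divPow 1ℚ (d ∸ d)) - x
    ≡⟨ cong₂ (λ y z → (y + x * divPow 1ℚ z) - x) (∑-cong d (λ i _ → ℚ.*-comm (divPow (c + fromℕ k) i) (divPow 1ℚ (d ∸ i)))) (ℕ.n∸n≡0 d) ⟩
  (∑[ i < d ] divPow 1ℚ (d ∸ i) * divPow (c + fromℕ k) i + x * 1ℚ) - x
    ≡⟨ solve 2 (λ y x → (y :+ x :* con 1ℚ) :- x := y) refl (∑[ i < d ] divPow 1ℚ (d ∸ i) * divPow (c + fromℕ k) i) x ⟩
  ∑[ i < d ] divPow 1ℚ (d ∸ i) * divPow (c + fromℕ k) i ∎
  where
  open ≡-Reasoning
  x : ℚ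
  x = divPow (c + fromℕ k) d

diff-divPow : ∀ n d c → d < n → diff n (λ k → divPow (c + fromℕ k) d) ≡ 0ℚ
diff-divPow (suc n) d c d<n = fromℕ-suc-*-cancelˡ n (begin
  fromℕ (suc n) * diff (suc n) (λ k → divPow (c + fromℕ k) d)
    ≡⟨ diff-suc n _ ⟩
  diff n (Δ (λ k → divPow (c + fromℕ k) d))
    ≡⟨ ∑-cong (suc n) (λ k _ → cong (diffCoeff n k *_) (Δ-divPow c d k)) ⟩
  diff n (λ k → ∑[ i < d ] divPow 1ℚ (d ∸ i) * divPow (c + fromℕ k) i)
    ≡⟨ diff-linear n d (λ i → divPow 1ℚ (d ∸ i)) (λ i k → divPow (c + fromℕ k) i) ⟩
  ∑[ i < d ] divPow 1ℚ (d ∸ i) * diff n (λ k → divPow (c + fromℕ k) i)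
    ≡⟨ ∑-zero d (λ i i<d → trans (cong (divPow 1ℚ (d ∸ i) *_) (diff-divPow n i c (ℕ.<-≤-trans i<d (ℕ.≤-pred d<n))))
                                  (ℚ.*-zeroʳ (divPow 1ℚ (d ∸ i)))) ⟩
  0ℚ
    ≡⟨ ℚ.*-zeroʳ (fromℕ (suc n)) ⟨
  fromℕ (suc n) * 0ℚ ∎)
  where open ≡-Reasoning

-- Abel's identity

abelPoly : ℚ → ℕ → ℚ
abelPoly x zero    = 1ℚ
abelPoly x (suc k) = x * (x + fromℕ (suc k)) ^ℚ k

abel : ℚ → ℕ → ℚ
abel x k = abelPoly x k * invFact k

abelSum : ℚ → ℕ → ℚ → ℚ
abelSum x n y = ∑[ k < suc n ] abel x k * divPow (y + fromℕ (n ∸ k)) (n ∸ k)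

abelPoly-*-^ : ∀ x m k → k ≤ suc m → abelPoly x k * (x + fromℕ k) ^ℚ (suc m ∸ k) ≡ x * (x + fromℕ k) ^ℚ m
abelPoly-*-^ x m zero    _ = solve 2 (λ x p → con 1ℚ :* ((x :+ con 0ℚ) :* p) := x :* p) refl x ((x + 0ℚ) ^ℚ m)
abelPoly-*-^ x m (suc k) (s≤s k≤m) = begin
  x * u ^ℚ k * u ^ℚ (m ∸ k)   ≡⟨ ℚ.*-assoc x _ _ ⟩
  x * (u ^ℚ k * u ^ℚ (m ∸ k)) ≡⟨ cong (x *_) (^ℚ-+ u k (m ∸ k)) ⟨
  x * u ^ℚ (k ℕ.+ (m ∸ k))    ≡⟨ cong (λ e → x * u ^ℚ e) (ℕ.m+[n∸m]≡n k≤m) ⟩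
  x * u ^ℚ m                  ∎
  where
  open ≡-Reasoning
  u : ℚ
  u = x + fromℕ (suc k)

-- At y = -(x + n) the k-th term is x (x + k)^(n - 1) times the k-th coefficient of the n-th
-- finite difference, so the whole sum is a finite difference of a polynomial of degree n - 1.
abelSum-vanishes : ∀ x m → abelSum x (suc m) (- (x + fromℕ (suc m))) ≡ 0ℚ
abelSum-vanishes x m = begin
  abelSum x n (- (x + fromℕ n))
    ≡⟨ ∑-cong (suc n) (λ k k≤n → term k (ℕ.≤-pred k≤n)) ⟩
  ∑[ k < suc n ] (x * fromℕ (m !)) * (diffCoeff n k * divPow (x + fromℕ k) m)
    ≡⟨ ∑-distribˡ (suc n) (x * fromℕ (m !)) _ ⟩
  (x * fromℕ (m !)) * diff n (λ k → divPow (x + fromℕ k) m)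
    ≡⟨ cong ((x * fromℕ (m !)) *_) (diff-divPow n m x ℕ.≤-refl) ⟩
  (x * fromℕ (m !)) * 0ℚ
    ≡⟨ ℚ.*-zeroʳ (x * fromℕ (m !)) ⟩
  0ℚ ∎
  where
  open ≡-Reasoning
  n : ℕ
  n = suc m
  term : ∀ k → k ≤ n →
    abel x k * divPow (- (x + fromℕ n) + fromℕ (n ∸ k)) (n ∸ k) ≡ (x * fromℕ (m !)) * (diffCoeff n k * divPow (x + fromℕ k) m)
  term k k≤n = begin
    abel x k * divPow (- (x + fromℕ n) + fromℕ (n ∸ k)) (n ∸ k)
      ≡⟨ cong (λ z → abel x k * divPow z (n ∸ k)) base ⟩
    abel x k * (((- 1ℚ) * u) ^ℚ (n ∸ k) * invFact (n ∸ k))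
      ≡⟨ cong (λ z → abel x k * (z * invFact (n ∸ k))) (^ℚ-distrib-* (- 1ℚ) u (n ∸ k)) ⟩
    abelPoly x k * invFact k * ((- 1ℚ) ^ℚ (n ∸ k) * u ^ℚ (n ∸ k) * invFact (n ∸ k))
      ≡⟨ solve 5 (λ p i s q j → p :* i :* (s :* q :* j) := s :* (i :* j) :* (p :* q)) refl
                 (abelPoly x k) (invFact k) ((- 1ℚ) ^ℚ (n ∸ k)) (u ^ℚ (n ∸ k)) (invFact (n ∸ k)) ⟩
    diffCoeff n k * (abelPoly x k * u ^ℚ (n ∸ k))
      ≡⟨ cong (diffCoeff n k *_) (abelPoly-*-^ x m k k≤n) ⟩
    diffCoeff n k * (x * u ^ℚ m)
      ≡⟨ cong (diffCoeff n k *_) (ℚ.*-identityʳ (x * u ^ℚ m)) ⟨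
    diffCoeff n k * (x * u ^ℚ m * 1ℚ)
      ≡⟨ cong (λ z → diffCoeff n k * (x * u ^ℚ m * z)) (fromℕ!-*-invFact m) ⟨
    diffCoeff n k * (x * u ^ℚ m * (fromℕ (m !) * invFact m))
      ≡⟨ solve 5 (λ c x p f i → c :* (x :* p :* (f :* i)) := (x :* f) :* (c :* (p :* i))) refl
                 (diffCoeff n k) x (u ^ℚ m) (fromℕ (m !)) (invFact m) ⟩
    (x * fromℕ (m !)) * (diffCoeff n k * divPow u m) ∎
    where
    u : ℚ
    u = x + fromℕ k
    base : - (x + fromℕ n) + fromℕ (n ∸ k) ≡ (- 1ℚ) * u
    base = trans (cong (- (x + fromℕ n) +_) (fromℕ-∸ k≤n))
      (solve 3 (λ x a b → (:- (x :+ a)) :+ (a :- b) := (:- con 1ℚ) :* (x :+ b)) refl x (fromℕ n) (fromℕ k))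

abelSum-shift : ∀ x n d y → abelSum x n (d + y) ≡ ∑[ j < suc n ] divPow d j * abelSum x (n ∸ j) (y + fromℕ j)
abelSum-shift x n d y = begin
  ∑[ k < suc n ] abel x k * divPow (d + y + fromℕ (n ∸ k)) (n ∸ k)
    ≡⟨ ∑-cong (suc n) (λ k _ → cong (abel x k *_) (expand k)) ⟩
  ∑[ k < suc n ] abel x k * binomialSum d (y + fromℕ (n ∸ k)) (n ∸ k)
    ≡⟨ ∑-cong (suc n) (λ k _ → sym (∑-distribˡ (suc (n ∸ k)) (abel x k) _)) ⟩
  ∑[ k < suc n ] ∑< (suc (n ∸ k)) (h k)
    ≡⟨ ∑-triangle-swap n h ⟩
  ∑[ j < suc n ] ∑[ k < suc (n ∸ j) ] h k j
    ≡⟨ ∑-cong (suc n) (λ j j<1+n → trans (∑-cong (suc (n ∸ j)) (λ k k<1+n∸j → reindex j k (ℕ.≤-pred j<1+n) (ℕ.≤-pred k<1+n∸j)))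
                                          (∑-distribˡ (suc (n ∸ j)) (divPow d j) _)) ⟩
  ∑[ j < suc n ] divPow d j * abelSum x (n ∸ j) (y + fromℕ j) ∎
  where
  open ≡-Reasoning
  expand : ∀ k → divPow (d + y + fromℕ (n ∸ k)) (n ∸ k) ≡ binomialSum d (y + fromℕ (n ∸ k)) (n ∸ k)
  expand k = trans (cong (λ z → divPow z (n ∸ k)) (ℚ.+-assoc d y _)) (binomial d (y + fromℕ (n ∸ k)) (n ∸ k))
  h : ℕ → ℕ → ℚ
  h k j = abel x k * (divPow d j * divPow (y + fromℕ (n ∸ k)) ((n ∸ k) ∸ j))
  reindex : ∀ j k → j ≤ n → k ≤ n ∸ j →
    h k j ≡ divPow d j * (abel x k * divPow ((y + fromℕ j) + fromℕ ((n ∸ j) ∸ k)) ((n ∸ j) ∸ k))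
  reindex j k j≤n k≤n∸j = begin
    abel x k * (divPow d j * divPow (y + fromℕ (n ∸ k)) ((n ∸ k) ∸ j))
      ≡⟨ cong₂ (λ z e → abel x k * (divPow d j * divPow z e)) base (∸-swap n k j) ⟩
    abel x k * (divPow d j * divPow ((y + fromℕ j) + fromℕ ((n ∸ j) ∸ k)) ((n ∸ j) ∸ k))
      ≡⟨ solve 3 (λ a b c → a :* (b :* c) := b :* (a :* c)) refl (abel x k) (divPow d j) _ ⟩
    divPow d j * (abel x k * divPow ((y + fromℕ j) + fromℕ ((n ∸ j) ∸ k)) ((n ∸ j) ∸ k)) ∎
    where
    base : y + fromℕ (n ∸ k) ≡ (y + fromℕ j) + fromℕ ((n ∸ j) ∸ k)
    base = begin
      y + fromℕ (n ∸ k)                           ≡⟨ cong (y +_) (fromℕ-∸ (ℕ.≤-trans k≤n∸j (ℕ.m∸n≤m n j))) ⟩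
      y + (fromℕ n - fromℕ k)                     ≡⟨ solve 4 (λ y a b c → y :+ (a :- c) := (y :+ b) :+ ((a :- b) :- c)) refl
                                                             y (fromℕ n) (fromℕ j) (fromℕ k) ⟩
      (y + fromℕ j) + ((fromℕ n - fromℕ j) - fromℕ k) ≡⟨ cong (λ z → (y + fromℕ j) + (z - fromℕ k)) (fromℕ-∸ j≤n) ⟨
      (y + fromℕ j) + (fromℕ (n ∸ j) - fromℕ k)       ≡⟨ cong ((y + fromℕ j) +_) (fromℕ-∸ k≤n∸j) ⟨
      (y + fromℕ j) + fromℕ ((n ∸ j) ∸ k)             ∎

∑-*-divPow-0 : ∀ (c : ℕ → ℚ) m → ∑[ j < suc m ] c j * divPow 0ℚ (m ∸ j) ≡ c m
∑-*-divPow-0 c m = begin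
  ∑[ j < m ] c j * divPow 0ℚ (m ∸ j) + c m * divPow 0ℚ (m ∸ m)
    ≡⟨ cong₂ (λ z e → z + c m * divPow 0ℚ e) (∑-zero m vanishes) (ℕ.n∸n≡0 m) ⟩
  0ℚ + c m * 1ℚ
    ≡⟨ solve 1 (λ a → con 0ℚ :+ a :* con 1ℚ := a) refl (c m) ⟩
  c m ∎
  where
  open ≡-Reasoning
  vanishes : ∀ j → j < m → c j * divPow 0ℚ (m ∸ j) ≡ 0ℚ
  vanishes j j<m rewrite ℕ.+-∸-assoc 1 j<m = trans (cong (c j *_) (divPow-0 (m ∸ suc j))) (ℚ.*-zeroʳ (c j))

-- Abel's identity  ∑ₖ C(n,k) x (x + k)^(k-1) (y + n - k)^(n-k) = (x + y + n)^n,  divided by n!.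
-- Expanding around y = -(x + n), only the two ends of abelSum-shift survive: the term j = 0
-- vanishes by abelSum-vanishes, and by induction the terms 0 < j < n are divided powers of 0.
abel-identity : ∀ n x y → abelSum x n y ≡ divPow (x + y + fromℕ n) n
abel-identity = <-rec _ step
  where
  step : ∀ n → (∀ {j} → j < n → ∀ x y → abelSum x j y ≡ divPow (x + y + fromℕ j) j) →
         ∀ x y → abelSum x n y ≡ divPow (x + y + fromℕ n) n
  step zero    _  x y = refl
  step (suc m) ih x y = begin
    abelSum x n y
      ≡⟨ cong (abelSum x n) (solve 3 (λ x y q → y := (x :+ y :+ q) :+ (:- (x :+ q))) refl x y (fromℕ n)) ⟩
    abelSum x n (d + y₀)
      ≡⟨ abelSum-shift x n d y₀ ⟩
    ∑[ j < suc n ] divPow d j * abelSum x (n ∸ j) (y₀ + fromℕ j)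
      ≡⟨ ∑-suc n _ ⟩
    divPow d 0 * abelSum x n (y₀ + 0ℚ) + ∑[ j < n ] divPow d (suc j) * abelSum x (m ∸ j) (y₀ + fromℕ (suc j))
      ≡⟨ cong₂ _+_ atZero (∑-cong n (λ j j<n → cong (divPow d (suc j) *_) (beyondZero j (ℕ.≤-pred j<n)))) ⟩
    0ℚ + ∑[ j < n ] divPow d (suc j) * divPow 0ℚ (m ∸ j)
      ≡⟨ trans (ℚ.+-identityˡ _) (∑-*-divPow-0 (λ j → divPow d (suc j)) m) ⟩
    divPow d n ∎
    where
    open ≡-Reasoning
    n : ℕ
    n = suc m
    d y₀ : ℚ
    d  = x + y + fromℕ n
    y₀ = - (x + fromℕ n)
    atZero : divPow d 0 * abelSum x n (y₀ + 0ℚ) ≡ 0ℚ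
    atZero = trans (cong (λ z → divPow d 0 * abelSum x n z) (ℚ.+-identityʳ y₀))
                   (trans (cong (divPow d 0 *_) (abelSum-vanishes x m)) (ℚ.*-zeroʳ (divPow d 0)))
    beyondZero : ∀ j → j ≤ m → abelSum x (m ∸ j) (y₀ + fromℕ (suc j)) ≡ divPow 0ℚ (m ∸ j)
    beyondZero j j≤m = trans (ih (s≤s (ℕ.m∸n≤m m j)) x (y₀ + fromℕ (suc j)))
      (cong (λ z → divPow z (m ∸ j)) (trans (cong (x + (y₀ + fromℕ (suc j)) +_) (fromℕ-∸ j≤m))
        (solve 3 (λ x a b → x :+ ((:- (x :+ (con 1ℚ :+ a))) :+ (con 1ℚ :+ b)) :+ (a :- b) := con 0ℚ) refl x (fromℕ m) (fromℕ j))))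

divPow-split : ∀ b j → divPow (b + fromℕ (suc j)) (suc j) ≡ abel b (suc j) + divPow (b + 1ℚ + fromℕ j) j
divPow-split b j = begin
  u * u ^ℚ j * invFact (suc j)
    ≡⟨ solve 4 (λ b q p i → (b :+ q) :* p :* i := b :* p :* i :+ p :* (q :* i)) refl b (fromℕ (suc j)) (u ^ℚ j) (invFact (suc j)) ⟩
  b * u ^ℚ j * invFact (suc j) + u ^ℚ j * (fromℕ (suc j) * invFact (suc j))
    ≡⟨ cong₂ (λ z w → b * u ^ℚ j * invFact (suc j) + z ^ℚ j * w)
             (solve 2 (λ b q → b :+ con 1ℚ :+ q := b :+ (con 1ℚ :+ q)) refl b (fromℕ j)) (invFact-suc j) ⟨
  abel b (suc j) + divPow (b + 1ℚ + fromℕ j) j ∎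
  where
  open ≡-Reasoning
  u : ℚ
  u = b + fromℕ (suc j)

abelSum-split : ∀ a b m →
  abelSum a (suc m) b ≡ ∑[ k < suc (suc m) ] abel a k * abel b (suc m ∸ k) + abelSum a m (b + 1ℚ)
abelSum-split a b m = begin
  ∑[ k < n ] abel a k * divPow (b + fromℕ (n ∸ k)) (n ∸ k) + abel a n * divPow (b + fromℕ (n ∸ n)) (n ∸ n)
    ≡⟨ cong₂ _+_ (∑-cong n (λ k k<n → split k (ℕ.≤-pred k<n))) last ⟩
  ∑[ k < n ] (P k + abel a k * divPow (b + 1ℚ + fromℕ (m ∸ k)) (m ∸ k)) + P n
    ≡⟨ cong (_+ P n) (∑-distrib-+ n P _) ⟩
  (∑< n P + abelSum a m (b + 1ℚ)) + P n
    ≡⟨ solve 3 (λ s t p → (s :+ t) :+ p := (s :+ p) :+ t) refl (∑< n P) (abelSum a m (b + 1ℚ)) (P n) ⟩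
  ∑< (suc n) P + abelSum a m (b + 1ℚ) ∎
  where
  open ≡-Reasoning
  n : ℕ
  n = suc m
  P : ℕ → ℚ
  P k = abel a k * abel b (n ∸ k)
  split : ∀ k → k ≤ m →
    abel a k * divPow (b + fromℕ (n ∸ k)) (n ∸ k) ≡ P k + abel a k * divPow (b + 1ℚ + fromℕ (m ∸ k)) (m ∸ k)
  split k k≤m rewrite ℕ.+-∸-assoc 1 k≤m =
    trans (cong (abel a k *_) (divPow-split b (m ∸ k))) (ℚ.*-distribˡ-+ (abel a k) _ _)
  last : abel a n * divPow (b + fromℕ (n ∸ n)) (n ∸ n) ≡ P n
  last rewrite ℕ.n∸n≡0 n = refl

divPow-suc-∸ : ∀ u m → divPow u (suc m) - divPow u m ≡ (u - fromℕ (suc m)) * u ^ℚ m * invFact (suc m)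
divPow-suc-∸ u m = begin
  u * u ^ℚ m * invFact (suc m) - u ^ℚ m * invFact m
    ≡⟨ cong (λ z → u * u ^ℚ m * invFact (suc m) - u ^ℚ m * z) (invFact-suc m) ⟩
  u * u ^ℚ m * invFact (suc m) - u ^ℚ m * (fromℕ (suc m) * invFact (suc m))
    ≡⟨ solve 4 (λ u p q i → u :* p :* i :- p :* (q :* i) := (u :- q) :* p :* i) refl u (u ^ℚ m) (fromℕ (suc m)) (invFact (suc m)) ⟩
  (u - fromℕ (suc m)) * u ^ℚ m * invFact (suc m) ∎
  where open ≡-Reasoning

abel-convolution : ∀ a b n → ∑[ k < suc n ] abel a k * abel b (n ∸ k) ≡ abel (a + b) n
abel-convolution a b zero    = refl
abel-convolution a b (suc m) = begin
  conv
    ≡⟨ solve 2 (λ c s → c := (c :+ s) :- s) refl conv (abelSum a m (b + 1ℚ)) ⟩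
  (conv + abelSum a m (b + 1ℚ)) - abelSum a m (b + 1ℚ)
    ≡⟨ cong₂ _-_ (sym (abelSum-split a b m)) refl ⟩
  abelSum a (suc m) b - abelSum a m (b + 1ℚ)
    ≡⟨ cong₂ _-_ (abel-identity (suc m) a b) (abel-identity m a (b + 1ℚ)) ⟩
  divPow (a + b + fromℕ (suc m)) (suc m) - divPow (a + (b + 1ℚ) + fromℕ m) m
    ≡⟨ cong (λ z → divPow (a + b + fromℕ (suc m)) (suc m) - divPow z m)
            (solve 3 (λ a b q → a :+ (b :+ con 1ℚ) :+ q := a :+ b :+ (con 1ℚ :+ q)) refl a b (fromℕ m)) ⟩
  divPow c (suc m) - divPow c m
    ≡⟨ divPow-suc-∸ c m ⟩
  (c - fromℕ (suc m)) * c ^ℚ m * invFact (suc m)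
    ≡⟨ cong (λ z → z * c ^ℚ m * invFact (suc m)) (solve 3 (λ a b q → a :+ b :+ q :- q := a :+ b) refl a b (fromℕ (suc m))) ⟩
  abel (a + b) (suc m) ∎
  where
  open ≡-Reasoning
  conv c : ℚ
  conv = ∑[ k < suc (suc m) ] abel a k * abel b (suc m ∸ k)
  c    = a + b + fromℕ (suc m)

abel-0 : ∀ k → abel 0ℚ (suc k) ≡ 0ℚ
abel-0 k = trans (cong (_* invFact (suc k)) (ℚ.*-zeroˡ ((0ℚ + fromℕ (suc k)) ^ℚ k))) (ℚ.*-zeroˡ (invFact (suc k)))

abel-neg-one : ∀ k → abel (- 1ℚ) (suc k) ≡ - (fromℕ k ^ℚ k * invFact (suc k))
abel-neg-one k = begin
  - 1ℚ * (- 1ℚ + fromℕ (suc k)) ^ℚ k * invFact (suc k)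
    ≡⟨ cong (λ z → - 1ℚ * z ^ℚ k * invFact (suc k)) (solve 1 (λ q → :- con 1ℚ :+ (con 1ℚ :+ q) := q) refl (fromℕ k)) ⟩
  - 1ℚ * fromℕ k ^ℚ k * invFact (suc k)
    ≡⟨ solve 2 (λ p i → :- con 1ℚ :* p :* i := :- (p :* i)) refl (fromℕ k ^ℚ k) (invFact (suc k)) ⟩
  - (fromℕ k ^ℚ k * invFact (suc k)) ∎
  where open ≡-Reasoning

weight-*-abel-one : ∀ k → weight (suc k) * abel 1ℚ k ≡ fromℕ k ^ℚ k * invFact (suc k)
weight-*-abel-one zero    = refl
weight-*-abel-one (suc i) = begin
  (1ℚ - ι) ^ℚ suc i * (1ℚ * fromℕ N ^ℚ i * invFact (suc i))
    ≡⟨ cong₂ (λ z w → z ^ℚ suc i * (1ℚ * fromℕ N ^ℚ i * w)) 1-ι (invFact-suc (suc i)) ⟩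
  (fromℕ (suc i) * ι) ^ℚ suc i * (1ℚ * fromℕ N ^ℚ i * (fromℕ N * invFact N))
    ≡⟨ cong (_* (1ℚ * fromℕ N ^ℚ i * (fromℕ N * invFact N))) (^ℚ-distrib-* (fromℕ (suc i)) ι (suc i)) ⟩
  fromℕ (suc i) ^ℚ suc i * ι ^ℚ suc i * (1ℚ * fromℕ N ^ℚ i * (fromℕ N * invFact N))
    ≡⟨ solve 5 (λ a b c d e → a :* b :* (con 1ℚ :* c :* (d :* e)) := (a :* e) :* (b :* (d :* c))) refl
               (fromℕ (suc i) ^ℚ suc i) (ι ^ℚ suc i) (fromℕ N ^ℚ i) (fromℕ N) (invFact N) ⟩
  (fromℕ (suc i) ^ℚ suc i * invFact N) * (ι ^ℚ suc i * fromℕ N ^ℚ suc i)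
    ≡⟨ cong ((fromℕ (suc i) ^ℚ suc i * invFact N) *_) (^ℚ-distrib-* ι (fromℕ N) (suc i)) ⟨
  (fromℕ (suc i) ^ℚ suc i * invFact N) * (ι * fromℕ N) ^ℚ suc i
    ≡⟨ cong (λ z → (fromℕ (suc i) ^ℚ suc i * invFact N) * z ^ℚ suc i) (trans (ℚ.*-comm ι (fromℕ N)) (fromℕ-*-inv N)) ⟩
  (fromℕ (suc i) ^ℚ suc i * invFact N) * 1ℚ ^ℚ suc i
    ≡⟨ trans (cong ((fromℕ (suc i) ^ℚ suc i * invFact N) *_) (1^ℚ (suc i))) (ℚ.*-identityʳ _) ⟩
  fromℕ (suc i) ^ℚ suc i * invFact N ∎
  where
  open ≡-Reasoning
  N : ℕ
  N = suc (suc i)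
  ι : ℚ
  ι = inv N
  1-ι : 1ℚ - ι ≡ fromℕ (suc i) * ι
  1-ι = trans (cong (_- ι) (sym (fromℕ-*-inv N))) (solve 2 (λ q i → (con 1ℚ :+ q) :* i :- i := q :* i) refl (fromℕ (suc i)) ι)

-- The convolution with a = -1, b = 1 sums to abel 0 (m + 1) = 0, and its k = 0 term is abel 1 (m + 1).
abel-one-suc : ∀ m → abel 1ℚ (suc m) ≡ ∑[ k < suc m ] weight (suc k) * abel 1ℚ k * abel 1ℚ (m ∸ k)
abel-one-suc m = begin
  abel 1ℚ (suc m)
    ≡⟨ solve 2 (λ a s → a := (con 1ℚ :* a :+ s) :- s) refl (abel 1ℚ (suc m)) S ⟩
  (1ℚ * abel 1ℚ (suc m) + S) - S
    ≡⟨ cong (_- S) (trans (sym (∑-suc (suc m) _)) (abel-convolution (- 1ℚ) 1ℚ (suc m))) ⟩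
  abel 0ℚ (suc m) - S
    ≡⟨ cong (_- S) (abel-0 m) ⟩
  0ℚ - S
    ≡⟨ trans (ℚ.+-identityˡ (- S)) (sym (∑-neg (suc m) _)) ⟩
  ∑[ k < suc m ] - (abel (- 1ℚ) (suc k) * abel 1ℚ (m ∸ k))
    ≡⟨ ∑-cong (suc m) (λ k _ → term k) ⟩
  ∑[ k < suc m ] weight (suc k) * abel 1ℚ k * abel 1ℚ (m ∸ k) ∎
  where
  open ≡-Reasoning
  S : ℚ
  S = ∑[ k < suc m ] abel (- 1ℚ) (suc k) * abel 1ℚ (m ∸ k)
  term : ∀ k → - (abel (- 1ℚ) (suc k) * abel 1ℚ (m ∸ k)) ≡ weight (suc k) * abel 1ℚ k * abel 1ℚ (m ∸ k)
  term k = begin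
    - (abel (- 1ℚ) (suc k) * abel 1ℚ (m ∸ k))              ≡⟨ cong (λ z → - (z * abel 1ℚ (m ∸ k))) (abel-neg-one k) ⟩
    - (- (fromℕ k ^ℚ k * invFact (suc k)) * abel 1ℚ (m ∸ k)) ≡⟨ solve 2 (λ t a → :- ((:- t) :* a) := t :* a) refl (fromℕ k ^ℚ k * invFact (suc k)) (abel 1ℚ (m ∸ k)) ⟩
    fromℕ k ^ℚ k * invFact (suc k) * abel 1ℚ (m ∸ k)         ≡⟨ cong (_* abel 1ℚ (m ∸ k)) (weight-*-abel-one k) ⟨
    weight (suc k) * abel 1ℚ k * abel 1ℚ (m ∸ k)             ∎

-- Sums over lists

sumℚ-map-++ : ∀ {A : Set} (F : A → ℚ) xs ys → sumℚ (map F (xs ++ ys)) ≡ sumℚ (map F xs) + sumℚ (map F ys)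
sumℚ-map-++ F []       ys = sym (ℚ.+-identityˡ _)
sumℚ-map-++ F (x ∷ xs) ys = trans (cong (F x +_) (sumℚ-map-++ F xs ys)) (sym (ℚ.+-assoc (F x) _ _))

productℚ-++ : ∀ xs ys → productℚ (xs ++ ys) ≡ productℚ xs * productℚ ys
productℚ-++ []       ys = sym (ℚ.*-identityˡ _)
productℚ-++ (x ∷ xs) ys = trans (cong (x *_) (productℚ-++ xs ys)) (sym (ℚ.*-assoc x _ _))

sumℚ-cartesianProductWith : ∀ {A B C : Set} (c : A → B → C) (F : C → ℚ) (f : A → ℚ) (g : B → ℚ) →
  (∀ x y → F (c x y) ≡ f x * g y) →
  ∀ xs ys → sumℚ (map F (cartesianProductWith c xs ys)) ≡ sumℚ (map f xs) * sumℚ (map g ys)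
sumℚ-cartesianProductWith c F f g F≡ []       ys = sym (ℚ.*-zeroˡ (sumℚ (map g ys)))
sumℚ-cartesianProductWith c F f g F≡ (x ∷ xs) ys = begin
  sumℚ (map F (map (c x) ys ++ cartesianProductWith c xs ys))
    ≡⟨ sumℚ-map-++ F (map (c x) ys) _ ⟩
  sumℚ (map F (map (c x) ys)) + sumℚ (map F (cartesianProductWith c xs ys))
    ≡⟨ cong₂ _+_ (row ys) (sumℚ-cartesianProductWith c F f g F≡ xs ys) ⟩
  f x * sumℚ (map g ys) + sumℚ (map f xs) * sumℚ (map g ys)
    ≡⟨ ℚ.*-distribʳ-+ (sumℚ (map g ys)) (f x) _ ⟨
  sumℚ (map f (x ∷ xs)) * sumℚ (map g ys) ∎
  where
  open ≡-Reasoning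
  row : ∀ ys → sumℚ (map F (map (c x) ys)) ≡ f x * sumℚ (map g ys)
  row []       = sym (ℚ.*-zeroʳ (f x))
  row (y ∷ ys) = trans (cong₂ _+_ (F≡ x y) (row ys)) (sym (ℚ.*-distribˡ-+ (f x) (g y) _))

sumℚ-map-unique : ∀ {A : Set} (F : A → ℚ) {xs ys : List A} → Unique xs → Unique ys →
  (∀ x → x ∈ xs ⇔ x ∈ ys) → sumℚ (map F xs) ≡ sumℚ (map F ys)
sumℚ-map-unique F xs-unique ys-unique same = foldr-commMonoid (setoid ℚ) ℚ.+-0-isCommutativeMonoid
  (↭⇒↭ₛ (↭.map⁺ F (∼bag⇒↭ (unique∧set⇒bag xs-unique ys-unique (same _)))))

-- Plane forests

forestWeight : List PTree → ℚ
forestWeight ts = productℚ (map hookWeight ts)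

hookWeight-node : ∀ ts → hookWeight (node ts) ≡ weight (suc (sizes ts)) * forestWeight ts
hookWeight-node ts = cong (weight (suc (sizes ts)) *_) (childHooks ts)
  where
  childHooks : ∀ ts → productℚ (map weight (hooksF ts)) ≡ forestWeight ts
  childHooks []       = refl
  childHooks (t ∷ ts) = begin
    productℚ (map weight (hooks t ++ hooksF ts))                      ≡⟨ cong productℚ (map-++ weight (hooks t) (hooksF ts)) ⟩
    productℚ (map weight (hooks t) ++ map weight (hooksF ts))         ≡⟨ productℚ-++ (map weight (hooks t)) _ ⟩
    hookWeight t * productℚ (map weight (hooksF ts))                  ≡⟨ cong (hookWeight t *_) (childHooks ts) ⟩
    forestWeight (t ∷ ts)                                             ∎
    where open ≡-Reasoning

sumℚ-hookWeight-node : ∀ k X → (∀ {f} → f ∈ X → sizes f ≡ k) →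
  sumℚ (map (λ f → hookWeight (node f)) X) ≡ weight (suc k) * sumℚ (map forestWeight X)
sumℚ-hookWeight-node k []      _     = sym (ℚ.*-zeroʳ (weight (suc k)))
sumℚ-hookWeight-node k (f ∷ X) sizes≡ = begin
  hookWeight (node f) + sumℚ (map (λ f → hookWeight (node f)) X)
    ≡⟨ cong₂ _+_ (trans (hookWeight-node f) (cong (λ s → weight (suc s) * forestWeight f) (sizes≡ (here refl))))
                 (sumℚ-hookWeight-node k X (sizes≡ ∘ there)) ⟩
  weight (suc k) * forestWeight f + weight (suc k) * sumℚ (map forestWeight X)
    ≡⟨ ℚ.*-distribˡ-+ (weight (suc k)) _ _ ⟨
  weight (suc k) * sumℚ (map forestWeight (f ∷ X)) ∎
  where open ≡-Reasoning

plant : List PTree → List PTree → List PTree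
plant ts f = node ts ∷ f

plant-injective : ∀ {w x y z} → plant w y ≡ plant x z → w ≡ x × y ≡ z
plant-injective refl = refl , refl

-- forests fuel m lists the forests with m vertices, each once, as soon as m < fuel; a forest
-- with m + 1 vertices lies in planted fuel m k, where k is the number of vertices below the
-- root of its first tree.
mutual
  forests : ℕ → ℕ → List (List PTree)
  forests _          zero    = [] ∷ []
  forests zero       (suc m) = []
  forests (suc fuel) (suc m) = plantedBelow fuel m (suc m)

  plantedBelow : ℕ → ℕ → ℕ → List (List PTree)
  plantedBelow fuel m zero    = []
  plantedBelow fuel m (suc k) = plantedBelow fuel m k ++ planted fuel m k

  planted : ℕ → ℕ → ℕ → List (List PTree)
  planted fuel m k = cartesianProductWith plant (forests fuel k) (forests fuel (m ∸ k))

∈-plantedBelow⁻ : ∀ fuel m K {f} → f ∈ plantedBelow fuel m K → ∃[ k ] k < K × f ∈ planted fuel m k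
∈-plantedBelow⁻ fuel m (suc K) f∈ with ∈-++⁻ (plantedBelow fuel m K) f∈
... | inj₁ f∈below with k , k<K , f∈k ← ∈-plantedBelow⁻ fuel m K f∈below = k , ℕ.m<n⇒m<1+n k<K , f∈k
... | inj₂ f∈K = K , ℕ.≤-refl , f∈K

∈-plantedBelow⁺ : ∀ fuel m K k {f} → k < K → f ∈ planted fuel m k → f ∈ plantedBelow fuel m K
∈-plantedBelow⁺ fuel m (suc K) k k<1+K f∈ with ℕ.m≤n⇒m<n∨m≡n (ℕ.≤-pred k<1+K)
... | inj₁ k<K  = ∈-++⁺ˡ (∈-plantedBelow⁺ fuel m K k k<K f∈)
... | inj₂ refl = ∈-++⁺ʳ (plantedBelow fuel m K) f∈

forests-sound : ∀ fuel m {f} → f ∈ forests fuel m → sizes f ≡ m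
forests-sound fuel       zero    (here refl) = refl
forests-sound (suc fuel) (suc m) f∈
  with k , s≤s k≤m , f∈k ← ∈-plantedBelow⁻ fuel m (suc m) f∈
  with g , h , g∈ , h∈ , refl ← ∈-cartesianProductWith⁻ plant (forests fuel k) (forests fuel (m ∸ k)) f∈k
  = cong suc (trans (cong₂ ℕ._+_ (forests-sound fuel k g∈) (forests-sound fuel (m ∸ k) h∈)) (ℕ.m+[n∸m]≡n k≤m))

forests-complete : ∀ fuel m f → m < fuel → sizes f ≡ m → f ∈ forests fuel m
forests-complete fuel       zero    []            _          _  = here refl
forests-complete fuel       zero    (node _ ∷ _)  _          ()
forests-complete (suc fuel) (suc m) []            _          ()
forests-complete (suc fuel) (suc m) (node g ∷ h) (s≤s m<fuel) eq =
  ∈-plantedBelow⁺ fuel m (suc m) k (s≤s k≤m)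
    (∈-cartesianProductWith⁺ plant (forests-complete fuel k g (ℕ.≤-<-trans k≤m m<fuel) refl)
                                   (forests-complete fuel (m ∸ k) h (ℕ.≤-<-trans (ℕ.m∸n≤m m k) m<fuel) h≡))
  where
  k : ℕ
  k = sizes g
  k+h≡m : k ℕ.+ sizes h ≡ m
  k+h≡m = ℕ.suc-injective eq
  k≤m : k ≤ m
  k≤m = subst (k ≤_) k+h≡m (ℕ.m≤m+n k (sizes h))
  h≡ : sizes h ≡ m ∸ k
  h≡ = trans (sym (ℕ.m+n∸m≡n k (sizes h))) (cong (_∸ k) k+h≡m)

mutual
  forests-unique : ∀ fuel m → Unique (forests fuel m)
  forests-unique _          zero    = All.[] ∷ []
  forests-unique zero       (suc m) = []
  forests-unique (suc fuel) (suc m) = plantedBelow-unique fuel m (suc m)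

  plantedBelow-unique : ∀ fuel m K → Unique (plantedBelow fuel m K)
  plantedBelow-unique fuel m zero    = []
  plantedBelow-unique fuel m (suc K) =
    Unique.++⁺ (plantedBelow-unique fuel m K)
               (Unique.cartesianProductWith⁺ plant plant-injective (forests-unique fuel K) (forests-unique fuel (m ∸ K)))
               disjoint
    where
    -- the children of the first root number fewer than K on the left, exactly K on the right
    disjoint : Disjoint (plantedBelow fuel m K) (planted fuel m K)
    disjoint (f∈below , f∈K)
      with k , k<K , f∈k ← ∈-plantedBelow⁻ fuel m K f∈below
      with g , _ , g∈ , _ , refl ← ∈-cartesianProductWith⁻ plant (forests fuel k) (forests fuel (m ∸ k)) f∈k
      with g′ , _ , g′∈ , _ , eq ← ∈-cartesianProductWith⁻ plant (forests fuel K) (forests fuel (m ∸ K)) f∈K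
      with refl , _ ← plant-injective eq
      = ℕ.<-irrefl (trans (sym (forests-sound fuel k g∈)) (forests-sound fuel K g′∈)) k<K

sumℚ-plantedBelow : ∀ (F : List PTree → ℚ) fuel m K →
  sumℚ (map F (plantedBelow fuel m K)) ≡ ∑[ k < K ] sumℚ (map F (planted fuel m k))
sumℚ-plantedBelow F fuel m zero    = refl
sumℚ-plantedBelow F fuel m (suc K) =
  trans (sumℚ-map-++ F (plantedBelow fuel m K) (planted fuel m K))
        (cong (_+ sumℚ (map F (planted fuel m K))) (sumℚ-plantedBelow F fuel m K))

forests-weight : ∀ fuel m → m < fuel → sumℚ (map forestWeight (forests fuel m)) ≡ abel 1ℚ m
forests-weight fuel       zero    _            = refl
forests-weight (suc fuel) (suc m) (s≤s m<fuel) = begin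
  sumℚ (map forestWeight (plantedBelow fuel m (suc m)))
    ≡⟨ sumℚ-plantedBelow forestWeight fuel m (suc m) ⟩
  ∑[ k < suc m ] sumℚ (map forestWeight (planted fuel m k))
    ≡⟨ ∑-cong (suc m) (λ k k<1+m → byFirstTree k (ℕ.≤-pred k<1+m)) ⟩
  ∑[ k < suc m ] weight (suc k) * abel 1ℚ k * abel 1ℚ (m ∸ k)
    ≡⟨ abel-one-suc m ⟨
  abel 1ℚ (suc m) ∎
  where
  open ≡-Reasoning
  byFirstTree : ∀ k → k ≤ m → sumℚ (map forestWeight (planted fuel m k)) ≡ weight (suc k) * abel 1ℚ k * abel 1ℚ (m ∸ k)
  byFirstTree k k≤m = begin
    sumℚ (map forestWeight (planted fuel m k))
      ≡⟨ sumℚ-cartesianProductWith plant forestWeight (λ g → hookWeight (node g)) forestWeight (λ _ _ → refl)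
                                   (forests fuel k) (forests fuel (m ∸ k)) ⟩
    sumℚ (map (λ g → hookWeight (node g)) (forests fuel k)) * sumℚ (map forestWeight (forests fuel (m ∸ k)))
      ≡⟨ cong₂ _*_ (sumℚ-hookWeight-node k (forests fuel k) (forests-sound fuel k))
                   (forests-weight fuel (m ∸ k) (ℕ.≤-<-trans (ℕ.m∸n≤m m k) m<fuel)) ⟩
    weight (suc k) * sumℚ (map forestWeight (forests fuel k)) * abel 1ℚ (m ∸ k)
      ≡⟨ cong (λ z → weight (suc k) * z * abel 1ℚ (m ∸ k)) (forests-weight fuel k (ℕ.≤-<-trans k≤m m<fuel)) ⟩
    weight (suc k) * abel 1ℚ k * abel 1ℚ (m ∸ k) ∎

trees : ℕ → List PTree
trees m = map node (forests (suc m) m)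

∈-trees : ∀ m T → T ∈ trees m ⇔ size T ≡ suc m
∈-trees m (node ts) = mk⇔ to from
  where
  to : node ts ∈ trees m → size (node ts) ≡ suc m
  to T∈ with ts′ , ts′∈ , refl ← ∈-map⁻ node T∈ = cong suc (forests-sound (suc m) m ts′∈)
  from : size (node ts) ≡ suc m → node ts ∈ trees m
  from eq = ∈-map⁺ node (forests-complete (suc m) m ts ℕ.≤-refl (ℕ.suc-injective eq))

trees-unique : ∀ m → Unique (trees m)
trees-unique m = Unique.map⁺ (λ { refl → refl }) (forests-unique (suc m) m)

trees-weight : ∀ m → sumℚ (map hookWeight (trees m)) ≡ weight (suc m) * abel 1ℚ m
trees-weight m = begin
  sumℚ (map hookWeight (map node (forests (suc m) m)))
    ≡⟨ cong sumℚ (map-∘ (forests (suc m) m)) ⟨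
  sumℚ (map (λ ts → hookWeight (node ts)) (forests (suc m) m))
    ≡⟨ sumℚ-hookWeight-node m (forests (suc m) m) (forests-sound (suc m) m) ⟩
  weight (suc m) * sumℚ (map forestWeight (forests (suc m) m))
    ≡⟨ cong (weight (suc m) *_) (forests-weight (suc m) m ℕ.≤-refl) ⟩
  weight (suc m) * abel 1ℚ m ∎
  where open ≡-Reasoning

theorem3p3 : (n : ℕ) → n ≥ 1 → (L : List PTree) → Unique L →
    (∀ T → (T ∈ L → size T ≡ n) × (size T ≡ n → T ∈ L)) →
    ℕtoℚ (n !) * sumℚ (map hookWeight L) ≡ ℕtoℚ ((n ∸ 1) ℕ.^ (n ∸ 1))
theorem3p3 (suc m) _ L L-unique L-enumerates = begin
  ℕtoℚ (suc m !) * sumℚ (map hookWeight L)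
    ≡⟨ cong₂ _*_ (ℕtoℚ≡fromℕ (suc m !)) (sumℚ-map-unique hookWeight L-unique (trees-unique m) L≈trees) ⟩
  fromℕ (suc m !) * sumℚ (map hookWeight (trees m))
    ≡⟨ cong (fromℕ (suc m !) *_) (trans (trees-weight m) (weight-*-abel-one m)) ⟩
  fromℕ (suc m !) * (fromℕ m ^ℚ m * invFact (suc m))
    ≡⟨ solve 3 (λ f p i → f :* (p :* i) := (f :* i) :* p) refl (fromℕ (suc m !)) (fromℕ m ^ℚ m) (invFact (suc m)) ⟩
  (fromℕ (suc m !) * invFact (suc m)) * fromℕ m ^ℚ m
    ≡⟨ trans (cong (_* fromℕ m ^ℚ m) (fromℕ!-*-invFact (suc m))) (ℚ.*-identityˡ (fromℕ m ^ℚ m)) ⟩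
  fromℕ m ^ℚ m
    ≡⟨ trans (ℕtoℚ≡fromℕ (m ℕ.^ m)) (fromℕ-^ m m) ⟨
  ℕtoℚ (m ℕ.^ m) ∎
  where
  open ≡-Reasoning
  L≈trees : ∀ T → T ∈ L ⇔ T ∈ trees m
  L≈trees T = mk⇔ (λ T∈L → Equivalence.from (∈-trees m T) (proj₁ (L-enumerates T) T∈L))
                  (λ T∈trees → proj₂ (L-enumerates T) (Equivalence.to (∈-trees m T) T∈trees))
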